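{- Let $d\ge1$, let $G$ be a graph without isolated vertices, and let $Z$ be a $d$-SMNBP representing $\psi(G)$. Let $x,y$ be vertices of $Z$ such that $Z$ has a path from $x$ to $y$ and every path of $Z$ from $x$ to $y$ is read-once. Let $b$ be a vertex lying on some path from $x$ to $y$, let $C$ be a clause of $\psi(x,y)$, and let $C'=C\cap V(x,b)$. Assume $\emptyset\ne C'\ne C$. Then one of the following holds: (1) for every path $P'\in\mathbf{P}(x,b,y)$, $A(P')\cap C'\ne\emptyset$; (2) for every path $P'\in\mathbf{P}(x,b,y)$, $A(P')\cap(C\setminus C')\ne\emptyset$.
   Context: $\psi(G)$ is the CNF with variable set $V(G)\cup E(G)$ and, for each edge $e=\{u,v\}$, the clause $(u\vee e\vee v)$ (a set of positive literals, identified with variables). An NBP is a directed acyclic graph, multiple edges allowed, with one source and one sink, some of whose edges are labelled with literals; $A(P)$ is the set of labels of path $P$. A satisfying assignment of $Z$ is an assignment $S$ to the variables labelling $Z$ such that some consistent source-sink path $P$ has $A(P)\subseteq S$; $Z$ represents $\psi(G)$ if its satisfying assignments are exactly those of $\psi(G)$. A path is read-once if no two of its edges are labelled with the same variable. A $d$-SMNBP is an NBP with no negative literal labels in which along every path each variable labels at most $d$ edges, and every source-sink path can be partitioned into at most $d$ edge-disjoint consecutive read-once subpaths. $\psi(x,y)$ is the set of clauses $C$ of $\psi(G)$ such that $A(P)\cap C\ne\emptyset$ for every path $P$ of $Z$ from $x$ to $y$. For vertices $a_1,a_2$, $V(a_1,a_2)$ is the set of variables labelling edges of paths of $Z$ from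 $a_1$ to $a_2$. $\mathbf{P}(x,b,y)$ is the set of paths of $Z$ from $x$ to $y$ passing through $b$. -}

module Defs where

open import Data.Nat using (ℕ; zero; suc; _≤_)
open import Data.Fin using (Fin; _≟_)
open import Data.Bool using (Bool; true)
open import Data.Maybe using (Maybe; just; nothing)
open import Data.Product using (Σ; ∃; ∃-syntax; _×_; _,_; proj₁; proj₂)
open import Data.Sum using (_⊎_; inj₁; inj₂)
open import Data.Sum.Properties using (≡-dec)
open import Data.List using (List; []; _∷_; _++_; concat; length; mapMaybe)
open import Data.List.Relation.Unary.All using (All)
open import Data.List.Relation.Unary.Unique.Propositional using (Unique)
open import Data.List.Membership.Propositional using (_∈_)
open import Relation.Binary.PropositionalEquality using (_≡_; _≢_)
open import Relation.Nullary using (¬_; yes; no)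
open import Function.Bundles using (_⇔_)

record Graph : Set where
  field
    n m       : ℕ
    endpoints : Fin m → Fin n × Fin n
    loopless  : ∀ e → proj₁ (endpoints e) ≢ proj₂ (endpoints e)
    simple    : ∀ e e' →
                (endpoints e ≡ endpoints e' ⊎
                 (proj₁ (endpoints e) ≡ proj₂ (endpoints e') ×
                  proj₂ (endpoints e) ≡ proj₁ (endpoints e'))) → e ≡ e'

open Graph public

NoIsolated : Graph → Set
NoIsolated G = ∀ (v : Fin (n G)) → ∃[ e ]
  (v ≡ proj₁ (endpoints G e) ⊎ v ≡ proj₂ (endpoints G e))

-- Variables of ψ(G): V(G) ∪ E(G)
Var : Graph → Set
Var G = Fin (n G) ⊎ Fin (m G)

-- The clause of ψ(G) belonging to edge e = {u,v} is (u ∨ e ∨ v);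
-- InClause G e w : variable w belongs to that clause.
InClause : (G : Graph) → Fin (m G) → Var G → Set
InClause G e w =
  w ≡ inj₁ (proj₁ (endpoints G e)) ⊎ (w ≡ inj₂ e ⊎ w ≡ inj₁ (proj₂ (endpoints G e)))

SatPsi : (G : Graph) → (Var G → Bool) → Set
SatPsi G S = ∀ (e : Fin (m G)) → ∃[ w ] (InClause G e w × S w ≡ true)

-- Branching programs whose labels are positive literals (variables of L)
-- or absent (nothing = unlabelled edge).

record BP (L : Set) : Set where
  field
    N E    : ℕ
    tl hd  : Fin E → Fin N
    label  : Fin E → Maybe L
    source sink : Fin N

open BP public

module _ {L : Set} (Z : BP L) where

  data IsPath : Fin (N Z) → List (Fin (E Z)) → Fin (N Z) → Set where
    []  : ∀ {a} → IsPath a [] a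
    _∷_ : ∀ {a b es} {e : Fin (E Z)} → tl Z e ≡ a → IsPath (hd Z e) es b →
          IsPath a (e ∷ es) b

  -- the sequence of labels of a path (A(P) is its set of elements)
  labels : List (Fin (E Z)) → List L
  labels = mapMaybe (label Z)

  IsNBP : Set
  IsNBP =
    (∀ a es → IsPath a es a → es ≡ []) ×
    (∀ e → hd Z e ≢ source Z) × (∀ e → tl Z e ≢ sink Z) ×
    (∀ v → (∀ e → hd Z e ≢ v) → v ≡ source Z) ×
    (∀ v → (∀ e → tl Z e ≢ v) → v ≡ sink Z)

  ReadOnce : List (Fin (E Z)) → Set
  ReadOnce es = Unique (labels es)

  RepresentsFn : ((L → Bool) → Set) → Set
  RepresentsFn f = ∀ (S : L → Bool) →
    (∃[ es ] (IsPath (source Z) es (sink Z) × All (λ w → S w ≡ true) (labels es)))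
    ⇔ f S

  InV : Fin (N Z) → Fin (N Z) → L → Set
  InV a₁ a₂ w = ∃[ es ] (IsPath a₁ es a₂ × w ∈ labels es)

  Through : Fin (N Z) → Fin (N Z) → Fin (N Z) → List (Fin (E Z)) → Set
  Through x b y es = ∃[ es₁ ] ∃[ es₂ ]
    (es ≡ es₁ ++ es₂ × IsPath x es₁ b × IsPath b es₂ y)

module _ {L : Set} (_≟L_ : ∀ (u v : L) → Relation.Nullary.Dec (u ≡ v)) where
  countLab : List L → L → ℕ
  countLab [] v = zero
  countLab (u ∷ us) v with u ≟L v
  ... | yes _ = suc (countLab us v)
  ... | no _  = countLab us v

_≟V_ : {G : Graph} → (u v : Var G) → Relation.Nullary.Dec (u ≡ v)
_≟V_ = ≡-dec _≟_ _≟_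

IsSMNBP : (G : Graph) → ℕ → BP (Var G) → Set
IsSMNBP G d Z =
  IsNBP Z ×
  (∀ a b es → IsPath Z a es b → ∀ v → countLab (_≟V_ {G}) (labels Z es) v ≤ d) ×
  (∀ es → IsPath Z (source Z) es (sink Z) →
     ∃[ ps ] (concat ps ≡ es × length ps ≤ d × All (ReadOnce Z) ps))

Represents : (G : Graph) → BP (Var G) → Set
Represents G Z = RepresentsFn Z (SatPsi G)

InPsiXY : (G : Graph) (Z : BP (Var G)) → Fin (N Z) → Fin (N Z) → Fin (m G) → Set
InPsiXY G Z x y e = ∀ es → IsPath Z x es y → ∃[ w ] (w ∈ labels Z es × InClause G e w)

module Submission where

-- Either some path from x to b avoids the clause C or none does.  If none does,
-- every path of P(x,b,y) meets C already on its x–b part, in a variable of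
-- V(x,b).  If Q avoids C, then for P' = P₁P₂ in P(x,b,y) the x–y path QP₂ must
-- meet C, necessarily on P₂; such a variable w is not in V(x,b), since on a path
-- R from x to b it would occur twice on the read-once x–y path RP₂.  The
-- dichotomy holds for every clause of ψ(x,y).  Constructively the case split
-- is a decision: the search for an avoiding path terminates because paths of an
-- acyclic program have fewer edges than it has vertices.

open import Defs
open import Data.Nat using (ℕ; zero; suc; _≤_; _<_; z≤n; s≤s)
open import Data.Nat.Properties using (_≤?_; ≰⇒>; <⇒≢; <⇒≤)
open import Data.Fin as Fin using (Fin; _≟_)
open import Data.Fin.Properties using (pigeonhole; any?)
open import Data.Product using (∃; ∃-syntax; _×_; _,_; proj₁; proj₂)
open import Data.Sum using (_⊎_; inj₁; inj₂)
open import Data.Empty using (⊥-elim)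
open import Data.List using (List; []; _∷_; [_]; _++_; length; map; lookup)
open import Data.List.Properties using (mapMaybe-++; length-map)
open import Data.List.Membership.Propositional using (_∈_; find; lose)
open import Data.List.Membership.Propositional.Properties using (∈-++⁺ˡ; ∈-++⁺ʳ; ∈-++⁻; ∈-lookup)
open import Data.List.Relation.Unary.Any using (here; there)
import Data.List.Relation.Unary.Any as Any
open import Data.List.Relation.Unary.All using (All; []; _∷_; all?; tabulate)
import Data.List.Relation.Unary.All as All
open import Data.List.Relation.Unary.All.Properties using (++⁺; ++⁻ˡ; ++⁻ʳ)
open import Data.List.Relation.Unary.AllPairs using ([]; _∷_)
open import Data.List.Relation.Unary.Unique.Propositional using (Unique)
open import Data.List.Relation.Binary.Disjoint.Propositional using (Disjoint)
open import Function using (_∘_)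
open import Relation.Nullary using (¬_; Dec; yes; no)
open import Relation.Nullary.Decidable using (map′; _×-dec_; _⊎-dec_; ¬?)
open import Relation.Unary using (Decidable)
open import Relation.Binary.PropositionalEquality using (_≡_; refl; sym; cong; subst)

Unique⇒lookup-injective : ∀ {A : Set} {xs : List A} → Unique xs →
                          ∀ i j → lookup xs i ≡ lookup xs j → i ≡ j
Unique⇒lookup-injective (_ ∷ _) Fin.zero Fin.zero _ = refl
Unique⇒lookup-injective (x∉ ∷ _) Fin.zero (Fin.suc j) eq =
  ⊥-elim (All.lookup x∉ (∈-lookup j) eq)
Unique⇒lookup-injective (x∉ ∷ _) (Fin.suc i) Fin.zero eq =
  ⊥-elim (All.lookup x∉ (∈-lookup i) (sym eq))
Unique⇒lookup-injective (_ ∷ u) (Fin.suc i) (Fin.suc j) eq =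
  cong Fin.suc (Unique⇒lookup-injective u i j eq)

Unique⇒length≤ : ∀ {n} {xs : List (Fin n)} → Unique xs → length xs ≤ n
Unique⇒length≤ {n} {xs} u with length xs ≤? n
... | yes ≤n = ≤n
... | no ≰n with pigeonhole (≰⇒> ≰n) (lookup xs)
...   | i , j , i<j , eq = ⊥-elim (<⇒≢ i<j (cong Fin.toℕ (Unique⇒lookup-injective u i j eq)))

Unique-++⇒Disjoint : ∀ {A : Set} (xs : List A) {ys : List A} →
                     Unique (xs ++ ys) → Disjoint xs ys
Unique-++⇒Disjoint (_ ∷ xs) (x∉ ∷ _) (here refl , v∈ys) = All.lookup x∉ (∈-++⁺ʳ xs v∈ys) refl
Unique-++⇒Disjoint (_ ∷ xs) (_ ∷ u) (there v∈xs , v∈ys) = Unique-++⇒Disjoint xs u (v∈xs , v∈ys)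

module _ {L : Set} (Z : BP L) where

  Acyclic : Set
  Acyclic = ∀ a es → IsPath Z a es a → es ≡ []

  IsPath-++ : ∀ {a b c es fs} → IsPath Z a es b → IsPath Z b fs c → IsPath Z a (es ++ fs) c
  IsPath-++ []      q = q
  IsPath-++ (t ∷ p) q = t ∷ IsPath-++ p q

  vertices : Fin (N Z) → List (Fin (E Z)) → List (Fin (N Z))
  vertices a es = a ∷ map (hd Z) es

  vertices-reachable : ∀ {a es c v} → IsPath Z a es c → v ∈ vertices a es →
                       ∃[ fs ] IsPath Z a fs v
  vertices-reachable p       (here refl) = [] , []
  vertices-reachable (t ∷ p) (there v∈) with vertices-reachable p v∈
  ... | fs , q = _ ∷ fs , t ∷ q

  Acyclic⇒Unique-vertices : Acyclic → ∀ {a es c} → IsPath Z a es c → Unique (vertices a es)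
  Acyclic⇒Unique-vertices acyclic []                      = [] ∷ []
  Acyclic⇒Unique-vertices acyclic {a} (_∷_ {e = e} t p) =
    tabulate a∉ ∷ Acyclic⇒Unique-vertices acyclic p
    where
    a∉ : ∀ {v} → v ∈ vertices (hd Z e) _ → ¬ a ≡ v
    a∉ v∈ refl with vertices-reachable p v∈
    ... | fs , q with acyclic a (e ∷ fs) (t ∷ q)
    ... | ()

  Acyclic⇒length< : Acyclic → ∀ {a es c} → IsPath Z a es c → length es < N Z
  Acyclic⇒length< acyclic {a} {es} p =
    subst (_≤ N Z) (cong suc (length-map (hd Z) es))
      (Unique⇒length≤ (Acyclic⇒Unique-vertices acyclic p))

  labels-++ : ∀ es fs → labels Z (es ++ fs) ≡ labels Z es ++ labels Z fs
  labels-++ = mapMaybe-++ (label Z)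

  module _ (acyclic : Acyclic) {P : L → Set} (P? : Decidable P) (b : Fin (N Z)) where

    PathTo : Fin (N Z) → List (Fin (E Z)) → Set
    PathTo a es = IsPath Z a es b × All P (labels Z es)

    pathWithin? : ∀ k a → Dec (∃[ es ] (PathTo a es × length es ≤ k))
    pathWithin? k a with a ≟ b
    ... | yes refl = yes ([] , ([] , []) , z≤n)
    pathWithin? zero    a | no a≢b = no λ { ([] , ([] , _) , _) → a≢b refl }
    pathWithin? (suc k) a | no a≢b = map′ extend shorten (any? step?)
      where
      Step : Fin (E Z) → Set
      Step e = tl Z e ≡ a × All P (labels Z [ e ]) × ∃[ es ] (PathTo (hd Z e) es × length es ≤ k)

      step? : Decidable Step
      step? e = (tl Z e ≟ a) ×-dec (all? P? _ ×-dec pathWithin? k (hd Z e))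

      extend : ∃ Step → ∃[ es ] (PathTo a es × length es ≤ suc k)
      extend (e , t , Pe , es , (p , Pes) , l) =
        e ∷ es , (t ∷ p , subst (All P) (sym (labels-++ [ e ] es)) (++⁺ Pe Pes)) , s≤s l

      shorten : ∃[ es ] (PathTo a es × length es ≤ suc k) → ∃ Step
      shorten ([] , ([] , _) , _) = ⊥-elim (a≢b refl)
      shorten (e ∷ es , (t ∷ p , Pes) , s≤s l) =
        let Pes′ = subst (All P) (labels-++ [ e ] es) Pes
        in e , t , ++⁻ˡ (labels Z [ e ]) Pes′ , es , (p , ++⁻ʳ (labels Z [ e ]) Pes′) , l

    pathTo? : ∀ a → Dec (∃[ es ] PathTo a es)
    pathTo? a = map′ (λ (es , p , _) → es , p)
                     (λ (es , p) → es , p , <⇒≤ (Acyclic⇒length< acyclic (proj₁ p)))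
                     (pathWithin? (N Z) a)

  Hits : (L → Set) → List (Fin (E Z)) → Set
  Hits C es = ∃[ w ] (w ∈ labels Z es × C w)

  hits? : ∀ {C : L → Set} → Decidable C → ∀ es → Dec (Hits C es)
  hits? C? es = map′ find (λ (_ , w∈ , c) → lose w∈ c) (Any.any? C? (labels Z es))

  ¬Hits⇒All¬ : ∀ {C : L → Set} {es} → ¬ Hits C es → All (¬_ ∘ C) (labels Z es)
  ¬Hits⇒All¬ ¬hit = tabulate λ w∈ c → ¬hit (_ , w∈ , c)

  ∈-labels-++⁺ˡ : ∀ {w} es {fs} → w ∈ labels Z es → w ∈ labels Z (es ++ fs)
  ∈-labels-++⁺ˡ es {fs} w∈ = subst (_ ∈_) (sym (labels-++ es fs)) (∈-++⁺ˡ w∈)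

  ∈-labels-++⁺ʳ : ∀ {w} es {fs} → w ∈ labels Z fs → w ∈ labels Z (es ++ fs)
  ∈-labels-++⁺ʳ es {fs} w∈ = subst (_ ∈_) (sym (labels-++ es fs)) (∈-++⁺ʳ (labels Z es) w∈)

  ∈-labels-++⁻ : ∀ {w} es {fs} → w ∈ labels Z (es ++ fs) → w ∈ labels Z es ⊎ w ∈ labels Z fs
  ∈-labels-++⁻ es {fs} w∈ = ∈-++⁻ (labels Z es) (subst (_ ∈_) (labels-++ es fs) w∈)

  ReadOnce-++⇒Disjoint : ∀ es {fs} → ReadOnce Z (es ++ fs) → Disjoint (labels Z es) (labels Z fs)
  ReadOnce-++⇒Disjoint es {fs} ro =
    Unique-++⇒Disjoint (labels Z es) (subst Unique (labels-++ es fs) ro)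

  module _ {C : L → Set} {x b y : Fin (N Z)} where

    Avoidable : Set
    Avoidable = ∃[ es ] (IsPath Z x es b × All (¬_ ∘ C) (labels Z es))

    ¬Avoidable⇒Through-Hits-inV : Decidable C → ¬ Avoidable →
      ∀ es → Through Z x b y es → Hits (λ w → C w × InV Z x b w) es
    ¬Avoidable⇒Through-Hits-inV C? ¬avoidable _ (es₁ , es₂ , refl , p₁ , _) with hits? C? es₁
    ... | yes (w , w∈ , c) = w , ∈-labels-++⁺ˡ es₁ w∈ , c , (es₁ , p₁ , w∈)
    ... | no ¬hit          = ⊥-elim (¬avoidable (es₁ , p₁ , ¬Hits⇒All¬ {es = es₁} ¬hit))

    Avoidable⇒Through-Hits-¬inV :
      (∀ es → IsPath Z x es y → ReadOnce Z es) → (∀ es → IsPath Z x es y → Hits C es) →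
      Avoidable → ∀ es → Through Z x b y es → Hits (λ w → C w × ¬ InV Z x b w) es
    Avoidable⇒Through-Hits-¬inV readOnce hits (Q , q , avoid) _ (es₁ , es₂ , refl , _ , p₂)
      with hits (Q ++ es₂) (IsPath-++ q p₂)
    ... | w , w∈ , c with ∈-labels-++⁻ Q w∈
    ...   | inj₁ w∈Q  = ⊥-elim (All.lookup avoid w∈Q c)
    ...   | inj₂ w∈es₂ = w , ∈-labels-++⁺ʳ es₁ w∈es₂ , c , λ (R , r , w∈R) →
            ReadOnce-++⇒Disjoint R (readOnce (R ++ es₂) (IsPath-++ r p₂)) (w∈R , w∈es₂)

InClause? : (G : Graph) (e : Fin (m G)) → Decidable (InClause G e)
InClause? G e w =
  (w ≟ᵥ inj₁ (proj₁ (endpoints G e))) ⊎-dec ((w ≟ᵥ inj₂ e) ⊎-dec (w ≟ᵥ inj₁ (proj₂ (endpoints G e))))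
  where
  _≟ᵥ_ : (u v : Var G) → Dec (u ≡ v)
  _≟ᵥ_ = _≟V_ {G}

lemma4 : (d : ℕ) → 1 ≤ d → (G : Graph) → NoIsolated G →
    (Z : BP (Var G)) → IsSMNBP G d Z → Represents G Z →
    (x y : Fin (N Z)) → (∃[ es ] IsPath Z x es y) →
    (∀ es → IsPath Z x es y → ReadOnce Z es) →
    (b : Fin (N Z)) → (∃[ es ] IsPath Z x es b) → (∃[ es ] IsPath Z b es y) →
    (e : Fin (m G)) → InPsiXY G Z x y e →
    (∃[ w ] (InClause G e w × InV Z x b w)) →
    (∃[ w ] (InClause G e w × ¬ InV Z x b w)) →
    (∀ es → Through Z x b y es →
       ∃[ w ] (w ∈ labels Z es × InClause G e w × InV Z x b w))
    ⊎
    (∀ es → Through Z x b y es →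
       ∃[ w ] (w ∈ labels Z es × InClause G e w × ¬ InV Z x b w))
lemma4 _ _ G _ Z ((acyclic , _) , _) _ x y _ readOnce b _ _ e ψxy _ _
  with pathTo? Z acyclic (¬? ∘ InClause? G e) b x
... | no ¬avoidable = inj₁ (¬Avoidable⇒Through-Hits-inV Z (InClause? G e) ¬avoidable)
... | yes avoidable = inj₂ (Avoidable⇒Through-Hits-¬inV Z readOnce ψxy avoidable)
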